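{- Let $n,m\ge3$ be odd integers, $S$ and $T$ 2-partitions of $\mathbb{Z}_n^*$ and $\mathbb{Z}_m^*$ respectively, and $X_m$ a nucleus of order $m$, and let $W^X_{ST}$ be an $X$-generated product. Then $W^X_{ST}$ is a strong 2-partition of $\mathbb{Z}_{mn}^*$ if and only if $X_m$ is skew in $\mathbb{Z}_m$, $S$ is strong and $T$ is strong. Likewise, $W^X_{ST}$ is a skew 2-partition of $\mathbb{Z}_{mn}^*$ if and only if $X_m$ is skew in $\mathbb{Z}_m$, $S$ is skew and $T$ is skew.
   Context: $\mathbb{Z}_k^*=\mathbb{Z}_k\setminus\{0\}$; a 2-partition of $\mathbb{Z}_k^*$ ($k$ odd) is a partition into unordered pairs $\{x_i,y_i\}$. It is strong if the sums $x_i+y_i\bmod k$ are all nonzero and pairwise distinct; skew if $\{\pm(x_i+y_i)\bmod k\}=\mathbb{Z}_k^*$. A nucleus of order $m$ is a set of ordered pairs $X_m=\{(u_i,v_i)\}_{i=1}^{m-1}\subset\mathbb{Z}_m^*\times\mathbb{Z}_m^*$ with $\{u_i\}=\{v_i\}=\mathbb{Z}_m^*$; it is skew if $\{(u_i+v_i)\bmod m: 1\le i\le m-1\}=\mathbb{Z}_m^*$. $X$-generated product: with $n=2q+1$, $m=2p+1$, let $\tilde S$ (resp. $\tilde T$) be any set of ordered pairs obtained by ordering each pair of $S$ (resp. $T$) in either way. $W^X_{ST}$ consists of the unordered pairs $\{nr+x,\ nt+y\}$ (mod $nm$, with $x,y$ represented in $\{0,\dots,n-1\}$) of two types: (i$_X$)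 one pair for each $(x,y)\in\tilde S$ and each $(r,t)\in\{(0,0)\}\cup X_m$; (ii$_X$) one pair for each $(r,t)\in\tilde T$ with $x=y=0$. -}

module Defs where

open import Data.Nat using (ℕ; zero; suc; _+_; _*_; _∸_; _≤_)
open import Data.Nat.DivMod using (_%_)
open import Data.Product using (_×_; _,_; proj₁; proj₂)
open import Data.List using (List; []; _∷_; _++_; map; concatMap; length; applyUpTo)
open import Data.List.Relation.Unary.All using (All)
open import Data.List.Relation.Unary.Any using (Any)
open import Data.List.Relation.Unary.Unique.Propositional using (Unique)
open import Data.List.Membership.Propositional using (_∈_)
open import Data.List.Relation.Binary.Permutation.Propositional using (_↭_)
open import Data.Sum using (_⊎_)
open import Function.Bundles using (_⇔_)
open import Relation.Binary.PropositionalEquality using (_≡_; _≢_)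

-- Residues mod k are represented by naturals in {0,…,k-1}.
-- x mod k (k ≥ 1 in all uses; the k = 0 clause is irrelevant)
_mod_ : ℕ → ℕ → ℕ
x mod zero = x
x mod suc k = x % suc k

Zstar : ℕ → List ℕ
Zstar k = applyUpTo suc (k ∸ 1)

negMod : ℕ → ℕ → ℕ
negMod k s = (k ∸ s) mod k

-- A family of pairs is a list of ordered pairs (x , y); an unordered pair
-- {x,y} is represented by either ordering (all notions below are symmetric).
Pairs : Set
Pairs = List (ℕ × ℕ)

flatten : Pairs → List ℕ
flatten = concatMap (λ p → proj₁ p ∷ proj₂ p ∷ [])

sums : ℕ → Pairs → List ℕ
sums k = map (λ p → (proj₁ p + proj₂ p) mod k)

-- P is a 2-partition of ℤ_k^*: the pairs are disjoint two-element sets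
-- covering ℤ_k^* exactly, i.e. the concatenation of the pairs is a
-- rearrangement of the list [1..k-1].
IsTwoPartition : ℕ → Pairs → Set
IsTwoPartition k P = flatten P ↭ Zstar k

IsStrong : ℕ → Pairs → Set
IsStrong k P = IsTwoPartition k P × All (λ s → s ≢ 0) (sums k P) × Unique (sums k P)

IsSkew : ℕ → Pairs → Set
IsSkew k P = IsTwoPartition k P ×
  (∀ z → (z ∈ Zstar k) ⇔ Any (λ s → z ≡ s ⊎ z ≡ negMod k s) (sums k P))

IsNucleus : ℕ → Pairs → Set
IsNucleus m X = length X ≡ m ∸ 1 ×
  (∀ z → (z ∈ Zstar m) ⇔ (z ∈ map proj₁ X)) ×
  (∀ z → (z ∈ Zstar m) ⇔ (z ∈ map proj₂ X))

IsSkewNucleus : ℕ → Pairs → Set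
IsSkewNucleus m X = ∀ z → (z ∈ Zstar m) ⇔ (z ∈ sums m X)

-- X-generated product W^X_{ST} in ℤ_{nm}, given orderings S̃ of S and T̃ of T
-- (lists of ordered pairs).
-- type (i): {nr + x, nt + y} for (x,y) ∈ S̃, (r,t) ∈ {(0,0)} ∪ X
-- type (ii): {nr, nt} for (r,t) ∈ T̃
typeI : ℕ → ℕ → Pairs → Pairs → Pairs
typeI n m S X = concatMap
  (λ xy → map (λ rt → ((n * proj₁ rt + proj₁ xy) mod (n * m) , (n * proj₂ rt + proj₂ xy) mod (n * m)))
              ((0 , 0) ∷ X))
  S

typeII : ℕ → ℕ → Pairs → Pairs
typeII n m T = map (λ rt → ((n * proj₁ rt) mod (n * m) , (n * proj₂ rt) mod (n * m))) T

Wprod : ℕ → ℕ → Pairs → Pairs → Pairs → Pairs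
Wprod n m S T X = typeI n m S X ++ typeII n m T

IsOdd : ℕ → Set
IsOdd n = n % 2 ≡ 1

-- Write residues modulo mn in mixed radix as q n + c with q < m and c < n. The pair
-- {n r + x, n t + y} of type (i) has sum with low digit (x + y) mod n and high digit
-- r + t + ε mod m, where ε ∈ {0, 1} is the carry of x + y; a pair of type (ii) has sum
-- with low digit 0 and high digit (r + t) mod m. Counting multiplicities digit by digit,
-- W is a 2-partition because S and T are and both coordinates of X run over ℤ_m^*.
-- If X is skew, then for each (x, y) ∈ S the high digits run over ℤ_m exactly once, so
-- q n + c occurs among the sums of W as often as c among the sums of S, plus (for c = 0)
-- as often as q among the sums of T; strength and skewness pass from S and T to W.
-- Conversely, summing over the fibre {q n + c : q < m} counts c among the sums of S m
-- times, which bounds S; the sums q n of type (ii) bound T; and a single (x, y) ∈ S shows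
-- that the sums of X, together with 0, hit each residue mod m at most once, hence
-- exactly once (they are m values), i.e. X is skew.

module Submission where

open import Data.Nat using (ℕ; zero; suc; _+_; _*_; _∸_; _≤_; _<_; z≤n; s≤s; pred; _/_; _%_; _≟_; _<?_)
open import Data.Nat.Properties
open import Data.Nat.DivMod hiding (_mod_)
open import Data.Nat.Solver using (module +-*-Solver)
open import Data.Product using (_×_; _,_; proj₁; proj₂; ∃)
open import Data.List using (List; []; _∷_; _++_; map; concatMap; length)
open import Data.List.Properties using (map-++; map-∘; length-map; length-++; length-applyUpTo; map-concatMap)
open import Data.List.Relation.Unary.All as All using (All; []; _∷_)
open import Data.List.Relation.Unary.All.Properties using () renaming (map⁺ to All-map⁺; map⁻ to All-map⁻)
open import Data.List.Relation.Unary.Any using (Any; here; there)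
open import Data.List.Relation.Unary.AllPairs using ([]; _∷_)
open import Data.List.Relation.Unary.Unique.Propositional using (Unique)
open import Data.List.Relation.Unary.Unique.Propositional.Properties using (applyUpTo⁺₁)
open import Data.List.Membership.Propositional using (_∈_)
open import Data.List.Membership.Propositional.Properties using (∈-∃++; ∈-applyUpTo⁺; ∈-applyUpTo⁻; ∈-map⁻)
open import Data.List.Relation.Binary.Permutation.Propositional as ↭ using (_↭_; ↭-sym)
open import Data.List.Relation.Binary.Permutation.Propositional.Properties using (shift; ↭-length; ∈-resp-↭)
open import Data.Sum using (_⊎_; inj₁; inj₂)
open import Data.Empty using (⊥-elim)
open import Function using (_∘_)
open import Function.Bundles using (_⇔_; mk⇔; Equivalence)
open import Relation.Binary.PropositionalEquality
open import Relation.Nullary using (yes; no; ¬_)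
open import Defs

open +-*-Solver using (solve; _:+_; _:*_; _:=_; con)
open Equivalence using (to; from)

-- Multiplicities

δ : ℕ → ℕ → ℕ
δ a b with a ≟ b
... | yes _ = 1
... | no _  = 0

δ-≡ : ∀ {a b} → a ≡ b → δ a b ≡ 1
δ-≡ {a} {b} a≡b with a ≟ b
... | yes _   = refl
... | no  a≢b = ⊥-elim (a≢b a≡b)

δ-≢ : ∀ {a b} → a ≢ b → δ a b ≡ 0
δ-≢ {a} {b} a≢b with a ≟ b
... | yes a≡b = ⊥-elim (a≢b a≡b)
... | no  _   = refl

mult : ℕ → List ℕ → ℕ
mult z []       = 0
mult z (w ∷ ws) = δ w z + mult z ws

mult-++ : ∀ z xs ys → mult z (xs ++ ys) ≡ mult z xs + mult z ys
mult-++ z []       ys = refl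
mult-++ z (w ∷ xs) ys = trans (cong (δ w z +_) (mult-++ z xs ys)) (sym (+-assoc (δ w z) _ _))

∈⇒0<mult : ∀ {z xs} → z ∈ xs → 0 < mult z xs
∈⇒0<mult {z} (here refl) rewrite δ-≡ {z} refl = s≤s z≤n
∈⇒0<mult {z} {w ∷ xs} (there z∈xs) = <-≤-trans (∈⇒0<mult z∈xs) (m≤n+m _ (δ w z))

0<mult⇒∈ : ∀ {z} xs → 0 < mult z xs → z ∈ xs
0<mult⇒∈ {z} (w ∷ xs) pos with w ≟ z
... | yes refl = here refl
... | no _     = there (0<mult⇒∈ xs pos)

mult≡0⇒∉ : ∀ {z xs} → mult z xs ≡ 0 → ¬ (z ∈ xs)
mult≡0⇒∉ e z∈xs = <⇒≢ (∈⇒0<mult z∈xs) (sym e)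

All≢⇒mult≡0 : ∀ {z} xs → All (_≢ z) xs → mult z xs ≡ 0
All≢⇒mult≡0 []       []           = refl
All≢⇒mult≡0 (w ∷ xs) (w≢z ∷ rest) rewrite δ-≢ w≢z = All≢⇒mult≡0 xs rest

mult≡0⇒All≢ : ∀ {z} xs → mult z xs ≡ 0 → All (_≢ z) xs
mult≡0⇒All≢ []       _ = []
mult≡0⇒All≢ (w ∷ xs) e = (λ w≡z → mult≡0⇒∉ {xs = w ∷ xs} e (here (sym w≡z))) ∷ mult≡0⇒All≢ xs (m+n≡0⇒n≡0 _ e)

Unique⇒mult≤1 : ∀ xs → Unique xs → ∀ z → mult z xs ≤ 1
Unique⇒mult≤1 []       _          z = z≤n
Unique⇒mult≤1 (w ∷ xs) (w∉ ∷ uniq) z with w ≟ z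
... | yes refl rewrite All≢⇒mult≡0 xs (All.map (_∘ sym) w∉) = s≤s z≤n
... | no _     = Unique⇒mult≤1 xs uniq z

mult≤1⇒Unique : ∀ xs → (∀ z → mult z xs ≤ 1) → Unique xs
mult≤1⇒Unique []       _   = []
mult≤1⇒Unique (w ∷ xs) ≤1 =
  All.map (_∘ sym) (mult≡0⇒All≢ xs (n≤0⇒n≡0 (+-cancelˡ-≤ 1 (mult w xs) 0 (subst (λ v → v + mult w xs ≤ 1) (δ-≡ {w} refl) (≤1 w)))))
  ∷ mult≤1⇒Unique xs (λ z → ≤-trans (m≤n+m _ (δ w z)) (≤1 z))

↭⇒mult≡ : ∀ {xs ys} → xs ↭ ys → ∀ z → mult z xs ≡ mult z ys
↭⇒mult≡ ↭.refl                   z = refl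
↭⇒mult≡ (↭.prep w p)             z = cong (δ w z +_) (↭⇒mult≡ p z)
↭⇒mult≡ (↭.swap {xs} {ys} u v p) z = begin
  δ u z + (δ v z + mult z xs) ≡⟨ solve 3 (λ a b c → a :+ (b :+ c) := b :+ (a :+ c)) refl (δ u z) (δ v z) (mult z xs) ⟩
  δ v z + (δ u z + mult z xs) ≡⟨ cong (λ t → δ v z + (δ u z + t)) (↭⇒mult≡ p z) ⟩
  δ v z + (δ u z + mult z ys) ∎
  where open ≡-Reasoning
↭⇒mult≡ (↭.trans p q)            z = trans (↭⇒mult≡ p z) (↭⇒mult≡ q z)

mult≡⇒↭ : ∀ xs ys → (∀ z → mult z xs ≡ mult z ys) → xs ↭ ys
mult≡⇒↭ []       []       _  = ↭.refl
mult≡⇒↭ []       (w ∷ ys) eq = ⊥-elim (mult≡0⇒∉ {w} {w ∷ ys} (sym (eq w)) (here refl))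
mult≡⇒↭ (w ∷ xs) ys       eq with ∈-∃++ (0<mult⇒∈ ys (subst (0 <_) (eq w) (∈⇒0<mult {w} {w ∷ xs} (here refl))))
... | us , vs , refl = ↭.trans (↭.prep w (mult≡⇒↭ xs (us ++ vs) eq′)) (↭-sym (shift w us vs))
  where
  eq′ : ∀ z → mult z xs ≡ mult z (us ++ vs)
  eq′ z = +-cancelˡ-≡ (δ w z) _ _ (begin
    δ w z + mult z xs                  ≡⟨ eq z ⟩
    mult z (us ++ w ∷ vs)              ≡⟨ mult-++ z us (w ∷ vs) ⟩
    mult z us + (δ w z + mult z vs)    ≡⟨ solve 3 (λ a b c → a :+ (b :+ c) := b :+ (a :+ c)) refl (mult z us) (δ w z) (mult z vs) ⟩
    δ w z + (mult z us + mult z vs)    ≡⟨ cong (δ w z +_) (sym (mult-++ z us vs)) ⟩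
    δ w z + mult z (us ++ vs)          ∎)
    where open ≡-Reasoning

mult≤mult-map : ∀ (f : ℕ → ℕ) a xs → mult a xs ≤ mult (f a) (map f xs)
mult≤mult-map f a []       = z≤n
mult≤mult-map f a (w ∷ xs) with w ≟ a
... | yes refl rewrite δ-≡ {f w} refl = s≤s (mult≤mult-map f a xs)
... | no _     = ≤-trans (mult≤mult-map f a xs) (m≤n+m _ _)

mult-outOfRange : ∀ {k z} xs → All (_< k) xs → k ≤ z → mult z xs ≡ 0
mult-outOfRange xs bounded k≤z = All≢⇒mult≡0 xs (All.map (λ w<k w≡z → <⇒≱ w<k (subst (_ ≤_) (sym w≡z) k≤z)) bounded)

-- Finite sums

sumBy : {A : Set} → (A → ℕ) → List A → ℕ
sumBy f []       = 0
sumBy f (x ∷ xs) = f x + sumBy f xs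

sumBy-cong : ∀ {A : Set} {f g : A → ℕ} xs → All (λ x → f x ≡ g x) xs → sumBy f xs ≡ sumBy g xs
sumBy-cong []       []         = refl
sumBy-cong (x ∷ xs) (eq ∷ eqs) = cong₂ _+_ eq (sumBy-cong xs eqs)

∈⇒≤sumBy : ∀ {A : Set} (f : A → ℕ) {x} xs → x ∈ xs → f x ≤ sumBy f xs
∈⇒≤sumBy f (y ∷ xs) (here refl) = m≤m+n (f y) _
∈⇒≤sumBy f (y ∷ xs) (there x∈) = ≤-trans (∈⇒≤sumBy f xs x∈) (m≤n+m _ (f y))

sumBy-δ : ∀ {A : Set} (f : A → ℕ) c ρ xs → sumBy (λ x → δ (f x) c * ρ) xs ≡ mult c (map f xs) * ρ
sumBy-δ f c ρ []       = refl
sumBy-δ f c ρ (x ∷ xs) = trans (cong (δ (f x) c * ρ +_) (sumBy-δ f c ρ xs)) (sym (*-distribʳ-+ ρ (δ (f x) c) _))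

mult-concatMap : ∀ {A : Set} z (f : A → List ℕ) xs → mult z (concatMap f xs) ≡ sumBy (λ x → mult z (f x)) xs
mult-concatMap z f []       = refl
mult-concatMap z f (x ∷ xs) = trans (mult-++ z (f x) (concatMap f xs)) (cong (mult z (f x) +_) (mult-concatMap z f xs))

length-concatMap : ∀ {A B : Set} (f : A → List B) xs → length (concatMap f xs) ≡ sumBy (length ∘ f) xs
length-concatMap f []       = refl
length-concatMap f (x ∷ xs) = trans (length-++ (f x)) (cong (length (f x) +_) (length-concatMap f xs))

sumBy-const : ∀ {A : Set} k (xs : List A) → sumBy (λ _ → k) xs ≡ length xs * k
sumBy-const k []       = refl
sumBy-const k (x ∷ xs) = cong (k +_) (sumBy-const k xs)

mult-map-const : ∀ {A : Set} (f : A → ℕ) v c xs → All (λ x → f x ≡ v) xs → mult c (map f xs) ≡ δ v c * length xs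
mult-map-const f v c []       []           = sym (*-zeroʳ (δ v c))
mult-map-const f v c (x ∷ xs) (fx≡v ∷ eqs) =
  trans (cong₂ _+_ (cong (λ u → δ u c) fx≡v) (mult-map-const f v c xs eqs)) (sym (*-suc (δ v c) (length xs)))

Σ< : (ℕ → ℕ) → ℕ → ℕ
Σ< f zero    = 0
Σ< f (suc B) = Σ< f B + f B

Σ<-cong : ∀ {f g} B → (∀ q → q < B → f q ≡ g q) → Σ< f B ≡ Σ< g B
Σ<-cong zero    _  = refl
Σ<-cong (suc B) eq = cong₂ _+_ (Σ<-cong B (λ q q<B → eq q (m<n⇒m<1+n q<B))) (eq B ≤-refl)

Σ<-mono-≤ : ∀ {f g} B → (∀ q → q < B → f q ≤ g q) → Σ< f B ≤ Σ< g B
Σ<-mono-≤ zero    _  = z≤n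
Σ<-mono-≤ (suc B) le = +-mono-≤ (Σ<-mono-≤ B (λ q q<B → le q (m<n⇒m<1+n q<B))) (le B ≤-refl)

Σ<-+ : ∀ f g B → Σ< (λ q → f q + g q) B ≡ Σ< f B + Σ< g B
Σ<-+ f g zero    = refl
Σ<-+ f g (suc B) rewrite Σ<-+ f g B =
  solve 4 (λ a b c d → (a :+ b) :+ (c :+ d) := (a :+ c) :+ (b :+ d)) refl (Σ< f B) (Σ< g B) (f B) (g B)

Σ<-*ˡ : ∀ k f B → Σ< (λ q → k * f q) B ≡ k * Σ< f B
Σ<-*ˡ k f zero    = sym (*-zeroʳ k)
Σ<-*ˡ k f (suc B) rewrite Σ<-*ˡ k f B = sym (*-distribˡ-+ k (Σ< f B) (f B))

Σ<-const : ∀ k B → Σ< (λ _ → k) B ≡ B * k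
Σ<-const k zero    = refl
Σ<-const k (suc B) rewrite Σ<-const k B = +-comm (B * k) k

Σ<-δ-outOfRange : ∀ w B → B ≤ w → Σ< (δ w) B ≡ 0
Σ<-δ-outOfRange w zero    _   = refl
Σ<-δ-outOfRange w (suc B) B<w rewrite Σ<-δ-outOfRange w B (<⇒≤ B<w) | δ-≢ (>⇒≢ B<w) = refl

Σ<-δ : ∀ w B → w < B → Σ< (δ w) B ≡ 1
Σ<-δ w (suc B) w<1+B with w ≟ B
... | yes refl rewrite Σ<-δ-outOfRange w w ≤-refl = refl
... | no  w≢B  rewrite Σ<-δ w B (≤∧≢⇒< (≤-pred w<1+B) w≢B) = refl

Σ<-mult : ∀ B xs → All (_< B) xs → Σ< (λ q → mult q xs) B ≡ length xs
Σ<-mult B []       []           = trans (Σ<-const 0 B) (*-zeroʳ B)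
Σ<-mult B (w ∷ xs) (w<B ∷ rest) rewrite Σ<-+ (δ w) (λ q → mult q xs) B | Σ<-δ w B w<B | Σ<-mult B xs rest = refl

χ₊ : ℕ → ℕ
χ₊ zero    = 0
χ₊ (suc _) = 1

χ₊≤1 : ∀ z → χ₊ z ≤ 1
χ₊≤1 zero    = z≤n
χ₊≤1 (suc _) = s≤s z≤n

Σ<-χ₊ : ∀ B → Σ< χ₊ (suc B) ≡ B
Σ<-χ₊ zero    = refl
Σ<-χ₊ (suc B) rewrite Σ<-χ₊ B = +-comm B 1

Σ<-squeeze : ∀ f g B → (∀ q → q < B → f q ≤ g q) → Σ< g B ≤ Σ< f B → ∀ q → q < B → f q ≡ g q
Σ<-squeeze f g (suc B) f≤g Σg≤Σf q q<1+B with m≤n⇒m<n∨m≡n (f≤g B ≤-refl)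
... | inj₁ fB<gB = ⊥-elim (<⇒≱ (+-mono-≤-< (Σ<-mono-≤ B (λ q q<B → f≤g q (m<n⇒m<1+n q<B))) fB<gB) Σg≤Σf)
... | inj₂ fB≡gB with m≤n⇒m<n∨m≡n (≤-pred q<1+B)
...   | inj₂ refl = fB≡gB
...   | inj₁ q<B  = Σ<-squeeze f g B (λ q q<B → f≤g q (m<n⇒m<1+n q<B))
                      (+-cancelʳ-≤ (f B) _ _ (subst (λ v → Σ< g B + v ≤ Σ< f B + f B) (sym fB≡gB) Σg≤Σf)) q q<B

covering⇒mult≡1 : ∀ B xs → All (_< B) xs → length xs ≡ B → (∀ q → q < B → 0 < mult q xs) → ∀ q → q < B → mult q xs ≡ 1
covering⇒mult≡1 B xs bounded len cover q q<B =
  sym (Σ<-squeeze (λ _ → 1) (λ q → mult q xs) B cover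
        (≤-reflexive (trans (Σ<-mult B xs bounded) (trans len (trans (sym (*-identityʳ B)) (sym (Σ<-const 1 B)))))) q q<B)

mult≤1⇒mult≡1 : ∀ B xs → All (_< B) xs → length xs ≡ B → (∀ q → q < B → mult q xs ≤ 1) → ∀ q → q < B → mult q xs ≡ 1
mult≤1⇒mult≡1 B xs bounded len ≤1 =
  Σ<-squeeze (λ q → mult q xs) (λ _ → 1) B ≤1
    (≤-reflexive (trans (Σ<-const 1 B) (trans (*-identityʳ B) (sym (trans (Σ<-mult B xs bounded) len)))))

-- ℤ_k^*, negation, and strong and skew lists of sums

∈Zstar⁺ : ∀ {k z} → 0 < z → z < k → z ∈ Zstar k
∈Zstar⁺ {suc k} {suc i} _ (s≤s i<k) = ∈-applyUpTo⁺ suc i<k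

∈Zstar⁻ : ∀ {k z} → z ∈ Zstar k → 0 < z × z < k
∈Zstar⁻ {suc k} z∈ with ∈-applyUpTo⁻ suc z∈
... | i , i<k , refl = s≤s z≤n , s≤s i<k

Zstar-bounded : ∀ k → All (_< k) (Zstar k)
Zstar-bounded k = All.tabulate (proj₂ ∘ ∈Zstar⁻)

mult-Zstar : ∀ {k} z → z < k → mult z (Zstar k) ≡ χ₊ z
mult-Zstar {k}     zero    _   = All≢⇒mult≡0 (Zstar k) (All.tabulate (λ w∈ w≡0 → <⇒≢ (proj₁ (∈Zstar⁻ {k} w∈)) (sym w≡0)))
mult-Zstar {suc k} (suc z) z<k = ≤-antisym
  (Unique⇒mult≤1 (Zstar (suc k)) (applyUpTo⁺₁ suc k (λ i<j _ e → <⇒≢ i<j (suc-injective e))) (suc z))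
  (∈⇒0<mult (∈Zstar⁺ {suc k} (s≤s z≤n) z<k))

δ0+χ₊≡1 : ∀ q → δ 0 q + χ₊ q ≡ 1
δ0+χ₊≡1 zero    = refl
δ0+χ₊≡1 (suc q) = refl

↭Zstar⇔mult≡1 : ∀ k xs → All (_< suc k) xs → (xs ↭ Zstar (suc k)) ⇔ (∀ q → q < suc k → mult q (0 ∷ xs) ≡ 1)
↭Zstar⇔mult≡1 k xs bounded = mk⇔
  (λ xs↭ q q<k → trans (cong (δ 0 q +_) (trans (↭⇒mult≡ xs↭ q) (mult-Zstar q q<k))) (δ0+χ₊≡1 q))
  (λ ≡1 → mult≡⇒↭ xs (Zstar (suc k)) (same-mult ≡1))
  where
  same-mult : (∀ q → q < suc k → mult q (0 ∷ xs) ≡ 1) → ∀ z → mult z xs ≡ mult z (Zstar (suc k))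
  same-mult ≡1 z with z <? suc k
  ... | yes z<k = +-cancelˡ-≡ (δ 0 z) _ _ (trans (≡1 z z<k) (sym (trans (cong (δ 0 z +_) (mult-Zstar z z<k)) (δ0+χ₊≡1 z))))
  ... | no  z≮k = trans (mult-outOfRange xs bounded (≮⇒≥ z≮k)) (sym (mult-outOfRange (Zstar (suc k)) (Zstar-bounded (suc k)) (≮⇒≥ z≮k)))

sameElements⇒↭Zstar : ∀ k xs → length xs ≡ k → (∀ z → (z ∈ Zstar (suc k)) ⇔ (z ∈ xs)) → xs ↭ Zstar (suc k)
sameElements⇒↭Zstar k xs len same =
  from (↭Zstar⇔mult≡1 k xs bounded) (covering⇒mult≡1 (suc k) (0 ∷ xs) (s≤s z≤n ∷ bounded) (cong suc len) cover)
  where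
  bounded : All (_< suc k) xs
  bounded = All.tabulate (λ {z} z∈ → proj₂ (∈Zstar⁻ (from (same z) z∈)))
  cover : ∀ q → q < suc k → 0 < mult q (0 ∷ xs)
  cover zero    _   = ∈⇒0<mult {xs = 0 ∷ xs} (here refl)
  cover (suc q) q<k = ∈⇒0<mult {xs = 0 ∷ xs} (there (to (same (suc q)) (∈Zstar⁺ {suc k} (s≤s z≤n) q<k)))

↭Zstar⇒sameElements : ∀ {k xs} → xs ↭ Zstar k → ∀ z → (z ∈ Zstar k) ⇔ (z ∈ xs)
↭Zstar⇒sameElements xs↭ z = mk⇔ (∈-resp-↭ (↭-sym xs↭)) (∈-resp-↭ xs↭)

sums-bounded : ∀ k P → All (_< suc k) (sums (suc k) P)
sums-bounded k P = All-map⁺ (All.tabulate (λ {p} _ → m%n<n (proj₁ p + proj₂ p) (suc k)))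

negMod< : ∀ k s → negMod (suc k) s < suc k
negMod< k s = m%n<n (suc k ∸ s) (suc k)

negMods-bounded : ∀ k xs → All (_< suc k) (map (negMod (suc k)) xs)
negMods-bounded k xs = All-map⁺ (All.tabulate (λ {s} _ → negMod< k s))

negMod-involutive : ∀ k s → s < suc k → negMod (suc k) (negMod (suc k) s) ≡ s
negMod-involutive k zero    _   = trans (cong (λ v → (suc k ∸ v) % suc k) (n%n≡0 (suc k))) (n%n≡0 (suc k))
negMod-involutive k (suc s) s<k = begin
  negMod (suc k) ((suc k ∸ suc s) % suc k) ≡⟨ cong (negMod (suc k)) (m<n⇒m%n≡m (s≤s (m∸n≤m k s))) ⟩
  (suc k ∸ (suc k ∸ suc s)) % suc k        ≡⟨ cong (_% suc k) (m∸[m∸n]≡n (<⇒≤ s<k)) ⟩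
  suc s % suc k                            ≡⟨ m<n⇒m%n≡m s<k ⟩
  suc s                                    ∎
  where open ≡-Reasoning

0<mult-negMod⇒0<mult : ∀ k xs c → All (_< suc k) xs → 0 < mult c (map (negMod (suc k)) xs) → 0 < mult (negMod (suc k) c) xs
0<mult-negMod⇒0<mult k xs c bounded pos with ∈-map⁻ (negMod (suc k)) (0<mult⇒∈ (map (negMod (suc k)) xs) pos)
... | s , s∈xs , refl = subst (λ v → 0 < mult v xs) (sym (negMod-involutive k s (All.lookup bounded s∈xs))) (∈⇒0<mult s∈xs)

strong⇔mult≤χ₊ : ∀ xs → (All (_≢ 0) xs × Unique xs) ⇔ (∀ z → mult z xs ≤ χ₊ z)
strong⇔mult≤χ₊ xs = mk⇔
  (λ (nonzero , uniq) → λ { zero    → ≤-reflexive (All≢⇒mult≡0 xs nonzero)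
                          ; (suc z) → Unique⇒mult≤1 xs uniq (suc z) })
  (λ bound → mult≡0⇒All≢ xs (n≤0⇒n≡0 (bound 0)) , mult≤1⇒Unique xs (λ z → ≤-trans (bound z) (χ₊≤1 z)))

SignedCover : ℕ → List ℕ → Set
SignedCover k xs = ∀ z → (z ∈ Zstar k) ⇔ Any (λ s → z ≡ s ⊎ z ≡ negMod k s) xs

mult± : ℕ → List ℕ → ℕ → ℕ
mult± k xs z = mult z xs + mult z (map (negMod k) xs)

any-±⇔0<mult± : ∀ {z} k xs → Any (λ s → z ≡ s ⊎ z ≡ negMod k s) xs ⇔ (0 < mult± k xs z)
any-±⇔0<mult± {z} k xs = mk⇔ (to′ xs) (from′ xs)
  where
  to′ : ∀ xs → Any (λ s → z ≡ s ⊎ z ≡ negMod k s) xs → 0 < mult± k xs z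
  to′ (w ∷ xs) (here (inj₁ refl)) = ≤-trans (∈⇒0<mult {xs = w ∷ xs} (here refl)) (m≤m+n _ (mult w (map (negMod k) (w ∷ xs))))
  to′ (w ∷ xs) (here (inj₂ refl)) = ≤-trans (∈⇒0<mult {xs = map (negMod k) (w ∷ xs)} (here refl)) (m≤n+m _ (mult (negMod k w) (w ∷ xs)))
  to′ (w ∷ xs) (there any)        = ≤-trans (to′ xs any) (+-mono-≤ (m≤n+m _ (δ w z)) (m≤n+m _ (δ (negMod k w) z)))
  from′ : ∀ xs → 0 < mult± k xs z → Any (λ s → z ≡ s ⊎ z ≡ negMod k s) xs
  from′ (w ∷ xs) pos with w ≟ z | negMod k w ≟ z
  ... | yes w≡z | _        = here (inj₁ (sym w≡z))
  ... | no _    | yes −w≡z = here (inj₂ (sym −w≡z))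
  ... | no _    | no _     = there (from′ xs pos)

Σ<-mult± : ∀ k xs → All (_< suc k) xs → 2 * length xs ≡ k → Σ< (mult± (suc k) xs) (suc k) ≡ Σ< χ₊ (suc k)
Σ<-mult± k xs bounded len = begin
  Σ< (mult± (suc k) xs) (suc k)
    ≡⟨ Σ<-+ (λ q → mult q xs) (λ q → mult q (map (negMod (suc k)) xs)) (suc k) ⟩
  Σ< (λ q → mult q xs) (suc k) + Σ< (λ q → mult q (map (negMod (suc k)) xs)) (suc k)
    ≡⟨ cong₂ _+_ (Σ<-mult (suc k) xs bounded)
                 (trans (Σ<-mult (suc k) _ (negMods-bounded k xs)) (length-map _ xs)) ⟩
  length xs + length xs
    ≡⟨ cong (length xs +_) (sym (+-identityʳ (length xs))) ⟩
  2 * length xs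
    ≡⟨ trans len (sym (Σ<-χ₊ k)) ⟩
  Σ< χ₊ (suc k) ∎
  where open ≡-Reasoning

χ₊≤mult±⇒≡ : ∀ k xs → All (_< suc k) xs → 2 * length xs ≡ k →
  (∀ z → z < suc k → χ₊ z ≤ mult± (suc k) xs z) → ∀ z → z < suc k → mult± (suc k) xs z ≡ χ₊ z
χ₊≤mult±⇒≡ k xs bounded len ≥χ₊ z z<k =
  sym (Σ<-squeeze χ₊ (mult± (suc k) xs) (suc k) ≥χ₊ (≤-reflexive (Σ<-mult± k xs bounded len)) z z<k)

mult±≤χ₊⇒≡ : ∀ k xs → All (_< suc k) xs → 2 * length xs ≡ k →
  (∀ z → z < suc k → mult± (suc k) xs z ≤ χ₊ z) → ∀ z → z < suc k → mult± (suc k) xs z ≡ χ₊ z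
mult±≤χ₊⇒≡ k xs bounded len ≤χ₊ =
  Σ<-squeeze (mult± (suc k) xs) χ₊ (suc k) ≤χ₊ (≤-reflexive (sym (Σ<-mult± k xs bounded len)))

signedCover⇒mult±≡χ₊ : ∀ k xs → All (_< suc k) xs → 2 * length xs ≡ k →
  SignedCover (suc k) xs → ∀ z → z < suc k → mult± (suc k) xs z ≡ χ₊ z
signedCover⇒mult±≡χ₊ k xs bounded len cover = χ₊≤mult±⇒≡ k xs bounded len ≥χ₊
  where
  ≥χ₊ : ∀ z → z < suc k → χ₊ z ≤ mult± (suc k) xs z
  ≥χ₊ zero    _   = z≤n
  ≥χ₊ (suc z) z<k = to (any-±⇔0<mult± (suc k) xs) (to (cover (suc z)) (∈Zstar⁺ {suc k} (s≤s z≤n) z<k))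

mult±≡χ₊⇒signedCover : ∀ k xs → All (_< suc k) xs →
  (∀ z → z < suc k → mult± (suc k) xs z ≡ χ₊ z) → SignedCover (suc k) xs
mult±≡χ₊⇒signedCover k xs bounded ≡χ₊ z = mk⇔
  (λ z∈ → let (0<z , z<k) = ∈Zstar⁻ z∈ in
          from (any-±⇔0<mult± (suc k) xs) (subst (0 <_) (sym (≡χ₊ z z<k)) (χ₊-pos 0<z)))
  (λ any → inZstar z (to (any-±⇔0<mult± (suc k) xs) any))
  where
  χ₊-pos : ∀ {z} → 0 < z → 0 < χ₊ z
  χ₊-pos {suc _} _ = s≤s z≤n
  inZstar : ∀ z → 0 < mult± (suc k) xs z → z ∈ Zstar (suc k)
  inZstar z pos with z <? suc k
  ... | no  z≮k = ⊥-elim (<⇒≢ pos (sym (cong₂ _+_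
                    (mult-outOfRange xs bounded (≮⇒≥ z≮k))
                    (mult-outOfRange (map (negMod (suc k)) xs) (negMods-bounded k xs) (≮⇒≥ z≮k)))))
  inZstar zero    pos | yes z<k = ⊥-elim (<⇒≢ pos (sym (≡χ₊ 0 z<k)))
  inZstar (suc z) _   | yes z<k = ∈Zstar⁺ {suc k} (s≤s z≤n) z<k

-- Two-partitions and nuclei

mult-flatten : ∀ z P → mult z (flatten P) ≡ mult z (map proj₁ P) + mult z (map proj₂ P)
mult-flatten z []            = refl
mult-flatten z ((x , y) ∷ P) rewrite mult-flatten z P =
  solve 4 (λ a b c d → a :+ (b :+ (c :+ d)) := (a :+ c) :+ (b :+ d)) refl (δ x z) (δ y z) (mult z (map proj₁ P)) (mult z (map proj₂ P))

length-flatten : ∀ P → length (flatten P) ≡ 2 * length P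
length-flatten []      = refl
length-flatten (_ ∷ P) rewrite length-flatten P = cong suc (sym (+-suc (length P) (length P + 0)))

twoPartition-length : ∀ k P → IsTwoPartition (suc k) P → 2 * length P ≡ k
twoPartition-length k P P↭ = trans (sym (length-flatten P)) (trans (↭-length P↭) (length-applyUpTo suc k))

twoPartition-length-sums : ∀ k P → IsTwoPartition (suc k) P → 2 * length (sums (suc k) P) ≡ k
twoPartition-length-sums k P P↭ = trans (cong (2 *_) (length-map _ P)) (twoPartition-length k P P↭)

Below : ℕ → ℕ × ℕ → Set
Below k p = proj₁ p < k × proj₂ p < k

twoPartition-bounded : ∀ k P → IsTwoPartition k P → All (Below k) P
twoPartition-bounded k P P↭ = All.zip (All-map⁻ (All.tabulate (below (m≤m+n _ _))) , All-map⁻ (All.tabulate (below (m≤n+m _ _))))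
  where
  below : ∀ {z xs} → mult z xs ≤ mult z (map proj₁ P) + mult z (map proj₂ P) → z ∈ xs → z < k
  below {z} le z∈ = proj₂ (∈Zstar⁻ (0<mult⇒∈ (Zstar k)
    (subst (0 <_) (trans (sym (mult-flatten z P)) (↭⇒mult≡ P↭ z)) (<-≤-trans (∈⇒0<mult z∈) le))))

nucleus-bounded : ∀ m X → IsNucleus m X → All (Below m) X
nucleus-bounded m X (_ , firsts , seconds) =
  All.zip (All-map⁻ (All.tabulate (λ {z} z∈ → proj₂ (∈Zstar⁻ (from (firsts z) z∈)))) ,
           All-map⁻ (All.tabulate (λ {z} z∈ → proj₂ (∈Zstar⁻ (from (seconds z) z∈)))))

-- Mixed-radix digits modulo m n

module Digits (n′ m′ : ℕ) where

  n m : ℕ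
  n = suc n′
  m = suc m′

  digits-%n : ∀ b s → s < n → (b * n + s) % n ≡ s
  digits-%n b s s<n = trans (cong (_% n) (+-comm (b * n) s)) (trans ([m+kn]%n≡m%n s b n) (m<n⇒m%n≡m s<n))

  digits-injective : ∀ b s q c → s < n → c < n → b * n + s ≡ q * n + c → b ≡ q × s ≡ c
  digits-injective b s q c s<n c<n eq = *-cancelʳ-≡ b q n (+-cancelʳ-≡ s (b * n) (q * n) (trans eq (cong (q * n +_) (sym s≡c)))) , s≡c
    where
    s≡c : s ≡ c
    s≡c = trans (sym (digits-%n b s s<n)) (trans (cong (_% n) eq) (digits-%n q c c<n))

  δ-digits : ∀ b s q c → s < n → c < n → δ (b * n + s) (q * n + c) ≡ δ s c * δ b q
  δ-digits b s q c s<n c<n with s ≟ c | b ≟ q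
  ... | yes refl | yes refl = δ-≡ {b * n + s} refl
  ... | yes refl | no  b≢q  = δ-≢ (b≢q ∘ proj₁ ∘ digits-injective b s q c s<n c<n)
  ... | no  s≢c  | _        = δ-≢ (s≢c ∘ proj₂ ∘ digits-injective b s q c s<n c<n)

  digits : ∀ w → w ≡ w / n * n + w % n
  digits w = trans (m≡m%n+[m/n]*n w n) (+-comm (w % n) _)

  /n< : ∀ w → w < m * n → w / n < m
  /n< w w<mn = m<n*o⇒m/o<n w<mn

  digits< : ∀ b s → b < m → s < n → b * n + s < m * n
  digits< b s b<m s<n = <-≤-trans (+-monoʳ-< (b * n) s<n) (≤-trans (≤-reflexive (+-comm (b * n) n)) (*-monoˡ-≤ n b<m))

  by-digits : (P : ℕ → Set) → (∀ q c → q < m → c < n → P (q * n + c)) → ∀ z → z < m * n → P z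
  by-digits P P-digits z z<mn = subst P (sym (digits z)) (P-digits (z / n) (z % n) (/n< z z<mn) (m%n<n z n))

  by-low-digit : (P : ℕ → Set) → (∀ q c → c < n → P (q * n + c)) → ∀ z → P z
  by-low-digit P P-digits z = subst P (sym (digits z)) (P-digits (z / n) (z % n) (m%n<n z n))

  embed : ∀ r x → r < m → x < n → (n * r + x) mod (n * m) ≡ r * n + x
  embed r x r<m x<n rewrite *-comm n r = m<n⇒m%n≡m (subst (r * n + x <_) (*-comm m n) (digits< r x r<m x<n))

  embed-high : ∀ r → r < m → (n * r) mod (n * m) ≡ r * n + 0
  embed-high r r<m = trans (cong (_mod (n * m)) (sym (+-identityʳ (n * r)))) (embed r 0 r<m (s≤s z≤n))

  digits-%mn : ∀ b s → s < n → (b * n + s) % (m * n) ≡ (b % m) * n + s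
  digits-%mn b s s<n = trans ([m*n+o]%[p*n]≡[m*n]%[p*n]+o b m s<n) (cong (_+ s) (sym (m%n*o≡m*o%[n*o] b m n)))

  carry≤1 : ∀ x y → x < n → y < n → (x + y) / n ≤ 1
  carry≤1 x y x<n y<n = ≤-pred (m<n*o⇒m/o<n {x + y} {2} {n} (subst (x + y <_) (cong (n +_) (sym (+-identityʳ n))) (+-mono-< x<n y<n)))

  +carry-surjective : ∀ e → e ≤ 1 → ∀ q → q < m → ∃ λ a → a < m × (a + e) % m ≡ q
  +carry-surjective zero          _ q       q<m = q , q<m , trans (cong (_% m) (+-identityʳ q)) (m<n⇒m%n≡m q<m)
  +carry-surjective (suc zero)    _ zero    _   = m′ , ≤-refl , trans (cong (_% m) (+-comm m′ 1)) (n%n≡0 m)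
  +carry-surjective (suc zero)    _ (suc q) q<m = q , <-trans (n<1+n q) q<m , trans (cong (_% m) (+-comm q 1)) (m<n⇒m%n≡m q<m)
  +carry-surjective (suc (suc e)) (s≤s ()) _ _

  sum-embedded : ∀ r t x y → r < m → t < m → x < n → y < n →
    ((n * r + x) mod (n * m) + (n * t + y) mod (n * m)) mod (m * n) ≡ (((r + t) % m + (x + y) / n) % m) * n + (x + y) % n
  sum-embedded r t x y r<m t<m x<n y<n rewrite embed r x r<m x<n | embed t y t<m y<n = begin
    (r * n + x + (t * n + y)) % (m * n)
      ≡⟨ cong (_% (m * n)) (solve 5 (λ r t n x y → r :* n :+ x :+ (t :* n :+ y) := (r :+ t) :* n :+ (x :+ y)) refl r t n x y) ⟩
    ((r + t) * n + (x + y)) % (m * n)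
      ≡⟨ cong (λ v → ((r + t) * n + v) % (m * n)) (digits (x + y)) ⟩
    ((r + t) * n + (e * n + s)) % (m * n)
      ≡⟨ cong (_% (m * n)) (solve 5 (λ r t n e s → (r :+ t) :* n :+ (e :* n :+ s) := (r :+ t :+ e) :* n :+ s) refl r t n e s) ⟩
    ((r + t + e) * n + s) % (m * n)
      ≡⟨ digits-%mn (r + t + e) s (m%n<n (x + y) n) ⟩
    ((r + t + e) % m) * n + s
      ≡⟨ cong (λ v → v * n + s) (%-distribˡ-+ (r + t) e m) ⟩
    (((r + t) % m + e % m) % m) * n + s
      ≡⟨ cong (λ v → ((v + e % m) % m) * n + s) (sym (m%n%n≡m%n (r + t) m)) ⟩
    (((r + t) % m % m + e % m) % m) * n + s
      ≡⟨ cong (λ v → v * n + s) (sym (%-distribˡ-+ ((r + t) % m) e m)) ⟩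
    (((r + t) % m + e) % m) * n + s ∎
    where
    open ≡-Reasoning
    s = (x + y) % n
    e = (x + y) / n

  sum-embedded-high : ∀ r t → r < m → t < m →
    ((n * r) mod (n * m) + (n * t) mod (n * m)) mod (m * n) ≡ ((r + t) % m) * n + 0
  sum-embedded-high r t r<m t<m rewrite embed-high r r<m | embed-high t t<m =
    trans (cong (_% (m * n)) (solve 3 (λ r t n → r :* n :+ con 0 :+ (t :* n :+ con 0) := (r :+ t) :* n :+ con 0) refl r t n))
          (digits-%mn (r + t) 0 (s≤s z≤n))

  negMod-high : ∀ a → a < m → negMod (m * n) (a * n + 0) ≡ negMod m a * n + 0
  negMod-high zero    _   = trans (n%n≡0 (m * n)) (sym (cong (λ v → v * n + 0) (n%n≡0 m)))
  negMod-high (suc a) a<m = begin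
    (m * n ∸ (suc a * n + 0)) % (m * n) ≡⟨ cong (λ v → (m * n ∸ v) % (m * n)) (+-identityʳ (suc a * n)) ⟩
    (m * n ∸ suc a * n) % (m * n)       ≡⟨ cong (_% (m * n)) (sym (*-distribʳ-∸ n m (suc a))) ⟩
    ((m ∸ suc a) * n) % (m * n)         ≡⟨ cong (_% (m * n)) (sym (+-identityʳ ((m ∸ suc a) * n))) ⟩
    ((m ∸ suc a) * n + 0) % (m * n)     ≡⟨ m<n⇒m%n≡m (digits< (m ∸ suc a) 0 m-a<m (s≤s z≤n)) ⟩
    (m ∸ suc a) * n + 0                 ≡⟨ cong (λ v → v * n + 0) (sym (m<n⇒m%n≡m m-a<m)) ⟩
    negMod m (suc a) * n + 0            ∎
    where
    open ≡-Reasoning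
    m-a<m : m ∸ suc a < m
    m-a<m = s≤s (m∸n≤m m′ a)

  negMod-%n : ∀ b s → b < m → s < n → negMod (m * n) (b * n + s) % n ≡ negMod n s
  negMod-%n b zero    b<m _   = trans (cong (_% n) (negMod-high b b<m)) (trans (digits-%n (negMod m b) 0 (s≤s z≤n)) (sym (n%n≡0 n)))
  negMod-%n b (suc s) b<m s<n = begin
    ((m * n ∸ (b * n + suc s)) % (m * n)) % n ≡⟨ cong (λ v → v % (m * n) % n) complement ⟩
    ((b′ * n + s′) % (m * n)) % n             ≡⟨ cong (_% n) (m<n⇒m%n≡m (digits< b′ s′ b′<m s′<n)) ⟩
    (b′ * n + s′) % n                         ≡⟨ digits-%n b′ s′ s′<n ⟩
    s′                                        ≡⟨ sym (m<n⇒m%n≡m s′<n) ⟩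
    negMod n (suc s)                          ∎
    where
    open ≡-Reasoning
    b′ = m′ ∸ b
    s′ = n ∸ suc s
    b′<m : b′ < m
    b′<m = s≤s (m∸n≤m m′ b)
    s′<n : s′ < n
    s′<n = s≤s (m∸n≤m n′ s)
    sum≡mn : b′ * n + s′ + (b * n + suc s) ≡ m * n
    sum≡mn = begin
      b′ * n + s′ + (b * n + suc s)
        ≡⟨ solve 5 (λ b′ n s′ b s → b′ :* n :+ s′ :+ (b :* n :+ s) := (b′ :+ b) :* n :+ (s′ :+ s)) refl b′ n s′ b (suc s) ⟩
      (b′ + b) * n + (s′ + suc s) ≡⟨ cong₂ (λ u v → u * n + v) (m∸n+n≡m (≤-pred b<m)) (m∸n+n≡m (<⇒≤ s<n)) ⟩
      m′ * n + n                  ≡⟨ +-comm (m′ * n) n ⟩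
      m * n                       ∎
    complement : m * n ∸ (b * n + suc s) ≡ b′ * n + s′
    complement = trans (cong (_∸ (b * n + suc s)) (sym sum≡mn)) (m+n∸n≡m (b′ * n + s′) (b * n + suc s))

  mult-digits-map : ∀ q c s → s < n → c < n → ∀ bs → mult (q * n + c) (map (λ b → b * n + s) bs) ≡ δ s c * mult q bs
  mult-digits-map q c s s<n c<n []       = sym (*-zeroʳ (δ s c))
  mult-digits-map q c s s<n c<n (b ∷ bs) =
    trans (cong₂ _+_ (δ-digits b s q c s<n c<n) (mult-digits-map q c s s<n c<n bs)) (sym (*-distribˡ-+ (δ s c) (δ b q) (mult q bs)))

  Σ<-mult-fibre : ∀ c → c < n → ∀ ws → All (_< m * n) ws → Σ< (λ q → mult (q * n + c) ws) m ≡ mult c (map (_% n) ws)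
  Σ<-mult-fibre c c<n []       []            = trans (Σ<-const 0 m) (*-zeroʳ m)
  Σ<-mult-fibre c c<n (w ∷ ws) (w<mn ∷ rest) =
    trans (Σ<-+ (λ q → δ w (q * n + c)) (λ q → mult (q * n + c) ws) m) (cong₂ _+_ fibre-of-w (Σ<-mult-fibre c c<n ws rest))
    where
    fibre-of-w : Σ< (λ q → δ w (q * n + c)) m ≡ δ (w % n) c
    fibre-of-w = begin
      Σ< (λ q → δ w (q * n + c)) m                 ≡⟨ Σ<-cong m (λ q _ → trans (cong (λ v → δ v (q * n + c)) (digits w))
                                                                          (δ-digits (w / n) (w % n) q c (m%n<n w n) c<n)) ⟩
      Σ< (λ q → δ (w % n) c * δ (w / n) q) m       ≡⟨ Σ<-*ˡ (δ (w % n) c) (δ (w / n)) m ⟩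
      δ (w % n) c * Σ< (δ (w / n)) m               ≡⟨ cong (δ (w % n) c *_) (Σ<-δ (w / n) m (/n< w w<mn)) ⟩
      δ (w % n) c * 1                              ≡⟨ *-identityʳ _ ⟩
      δ (w % n) c                                  ∎
      where open ≡-Reasoning

  χ₊-high : ∀ q → χ₊ (q * n + 0) ≡ χ₊ q
  χ₊-high zero    = refl
  χ₊-high (suc q) = refl

  χ₊-low : ∀ q c → χ₊ (q * n + suc c) ≡ 1
  χ₊-low q c rewrite +-suc (q * n) c = refl

  -- ℤ_{mn}^* consists of the qn + c with c ∈ ℤ_n^*, q ∈ ℤ_m, and of the qn with q ∈ ℤ_m^*.
  mult-Zstar-digits : ∀ q c → c < n →
    mult c (Zstar n) * mult q (0 ∷ Zstar m) + δ 0 c * mult q (Zstar m) ≡ mult (q * n + c) (Zstar (m * n))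
  mult-Zstar-digits q c c<n with q <? m
  ... | yes q<m rewrite mult-Zstar c c<n | mult-Zstar q q<m | δ0+χ₊≡1 q | mult-Zstar (q * n + c) (digits< q c q<m c<n) = by-low c
    where
    by-low : ∀ c → χ₊ c * 1 + δ 0 c * χ₊ q ≡ χ₊ (q * n + c)
    by-low zero    = trans (+-identityʳ (χ₊ q)) (sym (χ₊-high q))
    by-low (suc c) = sym (χ₊-low q c)
  ... | no  q≮m rewrite mult-outOfRange (0 ∷ Zstar m) (s≤s z≤n ∷ Zstar-bounded m) (≮⇒≥ q≮m)
                      | mult-outOfRange (Zstar m) (Zstar-bounded m) (≮⇒≥ q≮m)
                      | *-zeroʳ (mult c (Zstar n)) | *-zeroʳ (δ 0 c) =
    sym (mult-outOfRange (Zstar (m * n)) (Zstar-bounded (m * n)) (≤-trans (*-monoˡ-≤ n (≮⇒≥ q≮m)) (m≤m+n (q * n) c)))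

  -- Σ_{q<m} χ₊ (q n + c) is m − 1 for c = 0 and m otherwise.
  fibre-bound : ∀ k c → c < n → k * m ≤ Σ< (λ q → χ₊ (q * n + c)) m → k ≤ χ₊ c
  fibre-bound k zero    _ le = ≤-reflexive (k*m≤m′ k (subst (k * m ≤_) (trans (Σ<-cong m (λ q _ → χ₊-high q)) (Σ<-χ₊ m′)) le))
    where
    k*m≤m′ : ∀ k → k * m ≤ m′ → k ≡ 0
    k*m≤m′ zero    _  = refl
    k*m≤m′ (suc k) le = ⊥-elim (<⇒≱ (m≤m+n m (k * m)) le)
  fibre-bound k (suc c) _ le =
    *-cancelʳ-≤ k 1 m (subst (k * m ≤_) (trans (Σ<-cong m (λ q _ → χ₊-low q c)) (trans (Σ<-const 1 m) (trans (*-identityʳ m) (sym (*-identityˡ m))))) le)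

  mult-blocks : ∀ q c → c < n → (low : ℕ × ℕ → ℕ) (block : ℕ × ℕ → List ℕ) (ps : Pairs) → All (λ p → low p < n) ps →
    mult (q * n + c) (concatMap (λ p → map (λ b → b * n + low p) (block p)) ps) ≡ sumBy (λ p → δ (low p) c * mult q (block p)) ps
  mult-blocks q c c<n low block ps low<n = trans (mult-concatMap (q * n + c) (λ p → map (λ b → b * n + low p) (block p)) ps)
    (sumBy-cong ps (All.map (λ {p} lp<n → mult-digits-map q c (low p) lp<n c<n (block p)) low<n))

-- The X-generated product

module Product (n′ m′ : ℕ) (S T X : Pairs)
  (S-part : IsTwoPartition (suc n′) S) (T-part : IsTwoPartition (suc m′) T) (X-nucleus : IsNucleus (suc m′) X) where

  open Digits n′ m′

  N : ℕ
  N = m * n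

  W : Pairs
  W = Wprod n m S T X

  S-bounded : All (Below n) S
  S-bounded = twoPartition-bounded n S S-part

  T-bounded : All (Below m) T
  T-bounded = twoPartition-bounded m T T-part

  X₀ : Pairs
  X₀ = (0 , 0) ∷ X

  X₀-bounded : All (Below m) X₀
  X₀-bounded = (s≤s z≤n , s≤s z≤n) ∷ nucleus-bounded m X X-nucleus

  embedI : ℕ × ℕ → ℕ × ℕ → ℕ × ℕ
  embedI xy rt = (n * proj₁ rt + proj₁ xy) mod (n * m) , (n * proj₂ rt + proj₂ xy) mod (n * m)

  embedII : ℕ × ℕ → ℕ × ℕ
  embedII rt = (n * proj₁ rt) mod (n * m) , (n * proj₂ rt) mod (n * m)

  coords-typeI : (π : ℕ × ℕ → ℕ) → (∀ p rt → Below n p → Below m rt → π (embedI p rt) ≡ π rt * n + π p) →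
    ∀ ps → All (Below n) ps → map π (typeI n m ps X) ≡ concatMap (λ p → map (λ b → b * n + π p) (map π X₀)) ps
  coords-typeI π π-embedI []       []             = refl
  coords-typeI π π-embedI (p ∷ ps) (p<n ∷ ps<n) =
    trans (map-++ π (map (embedI p) X₀) (typeI n m ps X)) (cong₂ _++_ (block X₀ X₀-bounded) (coords-typeI π π-embedI ps ps<n))
    where
    block : ∀ rts → All (Below m) rts → map π (map (embedI p) rts) ≡ map (λ b → b * n + π p) (map π rts)
    block []         []           = refl
    block (rt ∷ rts) (rt<m ∷ rest) = cong₂ _∷_ (π-embedI p rt p<n rt<m) (block rts rest)

  coords-typeII : (π : ℕ × ℕ → ℕ) → (∀ rt → Below m rt → π (embedII rt) ≡ π rt * n + 0) →
    ∀ rts → All (Below m) rts → map π (typeII n m rts) ≡ map (λ b → b * n + 0) (map π rts)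
  coords-typeII π π-embedII []         []            = refl
  coords-typeII π π-embedII (rt ∷ rts) (rt<m ∷ rest) = cong₂ _∷_ (π-embedII rt rt<m) (coords-typeII π π-embedII rts rest)

  mult-coords : (π : ℕ × ℕ → ℕ) →
    (∀ p rt → Below n p → Below m rt → π (embedI p rt) ≡ π rt * n + π p) →
    (∀ rt → Below m rt → π (embedII rt) ≡ π rt * n + 0) →
    (∀ p → Below n p → π p < n) → ∀ q c → c < n →
    mult (q * n + c) (map π W) ≡ mult c (map π S) * mult q (map π X₀) + δ 0 c * mult q (map π T)
  mult-coords π π-embedI π-embedII π<n q c c<n = begin
    mult z (map π W)
      ≡⟨ cong (mult z) (map-++ π (typeI n m S X) (typeII n m T)) ⟩
    mult z (map π (typeI n m S X) ++ map π (typeII n m T))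
      ≡⟨ mult-++ z (map π (typeI n m S X)) (map π (typeII n m T)) ⟩
    mult z (map π (typeI n m S X)) + mult z (map π (typeII n m T))
      ≡⟨ cong₂ _+_ (cong (mult z) (coords-typeI π π-embedI S S-bounded)) (cong (mult z) (coords-typeII π π-embedII T T-bounded)) ⟩
    mult z (concatMap (λ p → map (λ b → b * n + π p) (map π X₀)) S) + mult z (map (λ b → b * n + 0) (map π T))
      ≡⟨ cong₂ _+_ (mult-blocks q c c<n π (λ _ → map π X₀) S (All.map (π<n _) S-bounded)) (mult-digits-map q c 0 (s≤s z≤n) c<n (map π T)) ⟩
    sumBy (λ p → δ (π p) c * mult q (map π X₀)) S + δ 0 c * mult q (map π T)
      ≡⟨ cong (_+ δ 0 c * mult q (map π T)) (sumBy-δ π c (mult q (map π X₀)) S) ⟩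
    mult c (map π S) * mult q (map π X₀) + δ 0 c * mult q (map π T) ∎
    where
    open ≡-Reasoning
    z = q * n + c

  W-isTwoPartition : IsTwoPartition N W
  W-isTwoPartition = mult≡⇒↭ (flatten W) (Zstar N) (by-low-digit (λ z → mult z (flatten W) ≡ mult z (Zstar N)) same-mult)
    where
    firsts↭ : map proj₁ X ↭ Zstar m
    firsts↭ = sameElements⇒↭Zstar m′ (map proj₁ X) (trans (length-map proj₁ X) (proj₁ X-nucleus)) (proj₁ (proj₂ X-nucleus))
    seconds↭ : map proj₂ X ↭ Zstar m
    seconds↭ = sameElements⇒↭Zstar m′ (map proj₂ X) (trans (length-map proj₂ X) (proj₁ X-nucleus)) (proj₂ (proj₂ X-nucleus))
    same-mult : ∀ q c → c < n → mult (q * n + c) (flatten W) ≡ mult (q * n + c) (Zstar N)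
    same-mult q c c<n = begin
      mult (q * n + c) (flatten W)
        ≡⟨ mult-flatten (q * n + c) W ⟩
      mult (q * n + c) (map proj₁ W) + mult (q * n + c) (map proj₂ W)
        ≡⟨ cong₂ _+_ (mult-coords proj₁ (λ p rt p<n rt<m → embed (proj₁ rt) (proj₁ p) (proj₁ rt<m) (proj₁ p<n))
                                         (λ rt rt<m → embed-high (proj₁ rt) (proj₁ rt<m)) (λ _ → proj₁) q c c<n)
                     (mult-coords proj₂ (λ p rt p<n rt<m → embed (proj₂ rt) (proj₂ p) (proj₂ rt<m) (proj₂ p<n))
                                         (λ rt rt<m → embed-high (proj₂ rt) (proj₂ rt<m)) (λ _ → proj₂) q c c<n) ⟩
      (a₁ * ρ₁ + i * b₁) + (a₂ * ρ₂ + i * b₂)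
        ≡⟨ cong₂ (λ u v → (a₁ * u + i * b₁) + (a₂ * v + i * b₂)) (cong (δ 0 q +_) (↭⇒mult≡ firsts↭ q)) (cong (δ 0 q +_) (↭⇒mult≡ seconds↭ q)) ⟩
      (a₁ * ρ + i * b₁) + (a₂ * ρ + i * b₂)
        ≡⟨ solve 6 (λ a₁ a₂ b₁ b₂ ρ i → (a₁ :* ρ :+ i :* b₁) :+ (a₂ :* ρ :+ i :* b₂) := (a₁ :+ a₂) :* ρ :+ i :* (b₁ :+ b₂)) refl a₁ a₂ b₁ b₂ ρ i ⟩
      (a₁ + a₂) * ρ + i * (b₁ + b₂)
        ≡⟨ cong₂ (λ u v → u * ρ + i * v) (trans (sym (mult-flatten c S)) (↭⇒mult≡ S-part c)) (trans (sym (mult-flatten q T)) (↭⇒mult≡ T-part q)) ⟩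
      mult c (Zstar n) * ρ + i * mult q (Zstar m)
        ≡⟨ mult-Zstar-digits q c c<n ⟩
      mult (q * n + c) (Zstar N) ∎
      where
      open ≡-Reasoning
      ρ  = mult q (0 ∷ Zstar m)
      ρ₁ = mult q (map proj₁ X₀)
      ρ₂ = mult q (map proj₂ X₀)
      i  = δ 0 c
      a₁ = mult c (map proj₁ S)
      a₂ = mult c (map proj₂ S)
      b₁ = mult q (map proj₁ T)
      b₂ = mult q (map proj₂ T)

  low carry : ℕ × ℕ → ℕ
  low p   = (proj₁ p + proj₂ p) % n
  carry p = (proj₁ p + proj₂ p) / n

  low<n : ∀ p → low p < n
  low<n p = m%n<n (proj₁ p + proj₂ p) n

  A₀ : List ℕ
  A₀ = 0 ∷ sums m X

  shifted : ℕ × ℕ → List ℕ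
  shifted p = map (λ a → (a + carry p) % m) A₀

  sumsI sumsII sumsW : List ℕ
  sumsI  = sums N (typeI n m S X)
  sumsII = sums N (typeII n m T)
  sumsW  = sums N W

  sumsW≡ : sumsW ≡ sumsI ++ sumsII
  sumsW≡ = map-++ _ (typeI n m S X) (typeII n m T)

  sumsI≡blocks : sumsI ≡ concatMap (λ p → map (λ b → b * n + low p) (shifted p)) S
  sumsI≡blocks = go S S-bounded
    where
    go : ∀ ps → All (Below n) ps → sums N (typeI n m ps X) ≡ concatMap (λ p → map (λ b → b * n + low p) (shifted p)) ps
    go []       []           = refl
    go (p ∷ ps) (p<n ∷ rest) = trans (map-++ _ (map (embedI p) X₀) (typeI n m ps X)) (cong₂ _++_ (block X₀ X₀-bounded) (go ps rest))
      where
      block : ∀ rts → All (Below m) rts →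
        sums N (map (embedI p) rts) ≡ map (λ b → b * n + low p) (map (λ a → (a + carry p) % m) (sums m rts))
      block []         []                   = refl
      block (rt ∷ rts) ((r<m , t<m) ∷ rest) =
        cong₂ _∷_ (sum-embedded (proj₁ rt) (proj₂ rt) (proj₁ p) (proj₂ p) r<m t<m (proj₁ p<n) (proj₂ p<n)) (block rts rest)

  sumsII≡high : sumsII ≡ map (λ a → a * n + 0) (sums m T)
  sumsII≡high = go T T-bounded
    where
    go : ∀ rts → All (Below m) rts → sums N (typeII n m rts) ≡ map (λ a → a * n + 0) (sums m rts)
    go []         []                   = refl
    go (rt ∷ rts) ((r<m , t<m) ∷ rest) = cong₂ _∷_ (sum-embedded-high (proj₁ rt) (proj₂ rt) r<m t<m) (go rts rest)

  mult-sumsW : ∀ z → mult z sumsW ≡ mult z sumsI + mult z sumsII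
  mult-sumsW z = trans (cong (mult z) sumsW≡) (mult-++ z sumsI sumsII)

  mult-sumsI : ∀ q c → c < n → mult (q * n + c) sumsI ≡ sumBy (λ p → δ (low p) c * mult q (shifted p)) S
  mult-sumsI q c c<n = trans (cong (mult (q * n + c)) sumsI≡blocks) (mult-blocks q c c<n low shifted S (All.tabulate (λ {p} _ → low<n p)))

  mult-sumsII : ∀ q c → c < n → mult (q * n + c) sumsII ≡ δ 0 c * mult q (sums m T)
  mult-sumsII q c c<n = trans (cong (mult (q * n + c)) sumsII≡high) (mult-digits-map q c 0 (s≤s z≤n) c<n (sums m T))

  sumsW-bounded : All (_< N) sumsW
  sumsW-bounded = sums-bounded (pred N) W

  sums-S-bounded : All (_< n) (sums n S)
  sums-S-bounded = sums-bounded n′ S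

  sums-T-bounded : All (_< m) (sums m T)
  sums-T-bounded = sums-bounded m′ T

  length-sumsW : 2 * length sumsW ≡ pred N
  length-sumsW = begin
    2 * length sumsW                                    ≡⟨ cong (2 *_) (trans (length-map _ W) (length-++ (typeI n m S X))) ⟩
    2 * (length (typeI n m S X) + length (typeII n m T)) ≡⟨ cong₂ (λ u v → 2 * (u + v)) length-typeI (length-map _ T) ⟩
    2 * (length S * m + length T)
      ≡⟨ solve 3 (λ s m t → con 2 :* (s :* m :+ t) := (con 2 :* s) :* m :+ con 2 :* t) refl (length S) m (length T) ⟩
    2 * length S * m + 2 * length T                     ≡⟨ cong₂ (λ u v → u * m + v) (twoPartition-length n′ S S-part) (twoPartition-length m′ T T-part) ⟩
    n′ * m + m′                                         ≡⟨ solve 2 (λ n′ m′ → n′ :* (con 1 :+ m′) :+ m′ := n′ :+ m′ :* (con 1 :+ n′)) refl n′ m′ ⟩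
    pred N                                              ∎
    where
    open ≡-Reasoning
    length-typeI : length (typeI n m S X) ≡ length S * m
    length-typeI = trans (length-concatMap _ S)
      (trans (sumBy-cong S (All.tabulate (λ _ → trans (length-map _ X₀) (cong suc (proj₁ X-nucleus))))) (sumBy-const m S))

  A₀-bounded : All (_< m) A₀
  A₀-bounded = s≤s z≤n ∷ sums-bounded m′ X

  length-A₀ : length A₀ ≡ m
  length-A₀ = cong suc (trans (length-map _ X) (proj₁ X-nucleus))

  skewNucleus⇔mult-A₀≡1 : IsSkewNucleus m X ⇔ (∀ q → q < m → mult q A₀ ≡ 1)
  skewNucleus⇔mult-A₀≡1 = mk⇔
    (λ skew → to (↭Zstar⇔mult≡1 m′ (sums m X) (sums-bounded m′ X))
                 (sameElements⇒↭Zstar m′ (sums m X) (trans (length-map _ X) (proj₁ X-nucleus)) skew))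
    (λ ≡1 → ↭Zstar⇒sameElements {m} (from (↭Zstar⇔mult≡1 m′ (sums m X) (sums-bounded m′ X)) ≡1))

  shifted-bounded : ∀ p → All (_< m) (shifted p)
  shifted-bounded p = All-map⁺ (All.tabulate {xs = A₀} (λ {a} _ → m%n<n (a + carry p) m))

  length-shifted : ∀ p → length (shifted p) ≡ m
  length-shifted p = trans (length-map (λ a → (a + carry p) % m) A₀) length-A₀

  shifted-mult≡1 : IsSkewNucleus m X → ∀ p → Below n p → ∀ q → q < m → mult q (shifted p) ≡ 1
  shifted-mult≡1 skew p (x<n , y<n) = covering⇒mult≡1 m (shifted p) (shifted-bounded p) (length-shifted p) cover
    where
    cover : ∀ q → q < m → 0 < mult q (shifted p)
    cover q q<m with +carry-surjective (carry p) (carry≤1 (proj₁ p) (proj₂ p) x<n y<n) q q<m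
    ... | a , a<m , shift-a≡q = <-≤-trans (subst (0 <_) (sym (to skewNucleus⇔mult-A₀≡1 skew a a<m)) (s≤s z≤n))
                                          (subst (λ v → mult a A₀ ≤ mult v (shifted p)) shift-a≡q (mult≤mult-map _ a A₀))

  mult-sumsW-skew : IsSkewNucleus m X → ∀ q c → q < m → c < n → mult (q * n + c) sumsW ≡ mult c (sums n S) + δ 0 c * mult q (sums m T)
  mult-sumsW-skew skew q c q<m c<n = trans (mult-sumsW (q * n + c)) (cong₂ _+_ (begin
    mult (q * n + c) sumsI                              ≡⟨ mult-sumsI q c c<n ⟩
    sumBy (λ p → δ (low p) c * mult q (shifted p)) S    ≡⟨ sumBy-cong S (All.map (λ {p} p<n → cong (δ (low p) c *_) (shifted-mult≡1 skew p p<n q q<m)) S-bounded) ⟩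
    sumBy (λ p → δ (low p) c * 1) S                     ≡⟨ sumBy-δ low c 1 S ⟩
    mult c (sums n S) * 1                               ≡⟨ *-identityʳ _ ⟩
    mult c (sums n S)                                   ∎) (mult-sumsII q c c<n))
    where open ≡-Reasoning

  mult-%n≤mult-sumsW : IsSkewNucleus m X → ∀ w → w < N → mult (w % n) (sums n S) ≤ mult w sumsW
  mult-%n≤mult-sumsW skew = by-digits (λ w → mult (w % n) (sums n S) ≤ mult w sumsW) λ q c q<m c<n →
    subst₂ _≤_ (cong (λ v → mult v (sums n S)) (sym (digits-%n q c c<n))) (sym (mult-sumsW-skew skew q c q<m c<n)) (m≤m+n _ _)

  shifted≤sumsI : ∀ {p} → p ∈ S → ∀ q → mult q (shifted p) ≤ mult (q * n + low p) sumsI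
  shifted≤sumsI {p} p∈S q = subst (mult q (shifted p) ≤_) (sym (mult-sumsI q (low p) (low<n p)))
    (subst (_≤ sumBy weighted S) (trans (cong (_* mult q (shifted p)) (δ-≡ {low p} refl)) (*-identityˡ _)) (∈⇒≤sumBy weighted S p∈S))
    where
    weighted : ℕ × ℕ → ℕ
    weighted p′ = δ (low p′) (low p) * mult q (shifted p′)

  S-nonempty : 2 ≤ n′ → ∃ (_∈ S)
  S-nonempty 2≤n′ = nonempty S (twoPartition-length n′ S S-part)
    where
    nonempty : ∀ ps → 2 * length ps ≡ n′ → ∃ (_∈ ps)
    nonempty []       len = ⊥-elim (<⇒≱ (subst (2 ≤_) (sym len) 2≤n′) z≤n)
    nonempty (p ∷ ps) _   = p , here refl

  skewNucleus-from-mult≤1 : 2 ≤ n′ → (∀ z → z < N → mult z sumsI ≤ 1) → IsSkewNucleus m X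
  skewNucleus-from-mult≤1 2≤n′ ≤1 with S-nonempty 2≤n′
  ... | p , p∈S = from skewNucleus⇔mult-A₀≡1 (mult≤1⇒mult≡1 m A₀ A₀-bounded length-A₀ (λ a a<m →
    ≤-trans (mult≤mult-map add-carry a A₀) (≤-trans (shifted≤sumsI p∈S (add-carry a)) (≤1 _ (digits< (add-carry a) (low p) (m%n<n (a + carry p) m) (low<n p))))))
    where
    add-carry : ℕ → ℕ
    add-carry a = (a + carry p) % m

  mult-map-sumsI : ∀ (g : ℕ → ℕ) (v : ℕ × ℕ → ℕ) c → (∀ p b → b < m → g (b * n + low p) ≡ v p) → mult c (map g sumsI) ≡ mult c (map v S) * m
  mult-map-sumsI g v c g≡v = begin
    mult c (map g sumsI)                           ≡⟨ cong (mult c ∘ map g) sumsI≡blocks ⟩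
    mult c (map g (concatMap block S))             ≡⟨ cong (mult c) (map-concatMap g block S) ⟩
    mult c (concatMap (map g ∘ block) S)           ≡⟨ mult-concatMap c (map g ∘ block) S ⟩
    sumBy (λ p → mult c (map g (block p))) S       ≡⟨ sumBy-cong S (All.tabulate (λ {p} _ → mult-block p)) ⟩
    sumBy (λ p → δ (v p) c * m) S                  ≡⟨ sumBy-δ v c m S ⟩
    mult c (map v S) * m                           ∎
    where
    open ≡-Reasoning
    block : ℕ × ℕ → List ℕ
    block p = map (λ b → b * n + low p) (shifted p)
    mult-block : ∀ p → mult c (map g (block p)) ≡ δ (v p) c * m
    mult-block p = begin
      mult c (map g (block p))                           ≡⟨ cong (mult c) (sym (map-∘ (shifted p))) ⟩
      mult c (map (λ b → g (b * n + low p)) (shifted p)) ≡⟨ mult-map-const _ (v p) c (shifted p) (All.map (g≡v p _) (shifted-bounded p)) ⟩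
      δ (v p) c * length (shifted p)                     ≡⟨ cong (δ (v p) c *_) (length-shifted p) ⟩
      δ (v p) c * m                                      ∎

  mult-map-sumsII : ∀ (g : ℕ → ℕ) v c → (∀ b → b < m → g (b * n + 0) ≡ v) → mult c (map g sumsII) ≡ δ v c * length T
  mult-map-sumsII g v c g≡v = begin
    mult c (map g sumsII)                              ≡⟨ cong (mult c ∘ map g) sumsII≡high ⟩
    mult c (map g (map (λ a → a * n + 0) (sums m T)))  ≡⟨ cong (mult c) (sym (map-∘ (sums m T))) ⟩
    mult c (map (λ a → g (a * n + 0)) (sums m T))      ≡⟨ mult-map-const _ v c (sums m T) (All.map (g≡v _) sums-T-bounded) ⟩
    δ v c * length (sums m T)                          ≡⟨ cong (δ v c *_) (length-map _ T) ⟩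
    δ v c * length T                                   ∎
    where open ≡-Reasoning

  mult-map-sumsW : ∀ (g : ℕ → ℕ) (v : ℕ × ℕ → ℕ) v₀ c → (∀ p b → b < m → g (b * n + low p) ≡ v p) → (∀ b → b < m → g (b * n + 0) ≡ v₀) →
    mult c (map g sumsW) ≡ mult c (map v S) * m + δ v₀ c * length T
  mult-map-sumsW g v v₀ c g≡v g≡v₀ = begin
    mult c (map g sumsW)                          ≡⟨ cong (mult c ∘ map g) sumsW≡ ⟩
    mult c (map g (sumsI ++ sumsII))              ≡⟨ cong (mult c) (map-++ g sumsI sumsII) ⟩
    mult c (map g sumsI ++ map g sumsII)          ≡⟨ mult-++ c (map g sumsI) (map g sumsII) ⟩
    mult c (map g sumsI) + mult c (map g sumsII)  ≡⟨ cong₂ _+_ (mult-map-sumsI g v c g≡v) (mult-map-sumsII g v₀ c g≡v₀) ⟩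
    mult c (map v S) * m + δ v₀ c * length T      ∎
    where open ≡-Reasoning

  negN : ℕ → ℕ
  negN = negMod N

  Σ<-fibre-sumsW : ∀ c → c < n → Σ< (λ q → mult (q * n + c) sumsW) m ≡ mult c (sums n S) * m + δ 0 c * length T
  Σ<-fibre-sumsW c c<n = trans (Σ<-mult-fibre c c<n sumsW sumsW-bounded)
    (mult-map-sumsW (_% n) low 0 c (λ p b _ → digits-%n b (low p) (low<n p)) (λ b _ → digits-%n b 0 (s≤s z≤n)))

  Σ<-fibre-negSumsW : ∀ c → c < n →
    Σ< (λ q → mult (q * n + c) (map negN sumsW)) m ≡ mult c (map (negMod n) (sums n S)) * m + δ 0 c * length T
  Σ<-fibre-negSumsW c c<n = begin
    Σ< (λ q → mult (q * n + c) (map negN sumsW)) m ≡⟨ Σ<-mult-fibre c c<n (map negN sumsW) (negMods-bounded (pred N) sumsW) ⟩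
    mult c (map (_% n) (map negN sumsW))           ≡⟨ cong (mult c) (sym (map-∘ sumsW)) ⟩
    mult c (map ((_% n) ∘ negN) sumsW)             ≡⟨ mult-map-sumsW ((_% n) ∘ negN) (negMod n ∘ low) 0 c
                                                        (λ p b b<m → negMod-%n b (low p) b<m (low<n p))
                                                        (λ b b<m → trans (negMod-%n b 0 b<m (s≤s z≤n)) (n%n≡0 n)) ⟩
    mult c (map (negMod n ∘ low) S) * m + δ 0 c * length T
                                                   ≡⟨ cong (λ L → mult c L * m + δ 0 c * length T) (map-∘ S) ⟩
    mult c (map (negMod n) (sums n S)) * m + δ 0 c * length T ∎
    where open ≡-Reasoning

  Σ<-fibre-mult± : ∀ c → c < n →
    Σ< (λ q → mult± N sumsW (q * n + c)) m ≡ mult± n (sums n S) c * m + (δ 0 c * length T + δ 0 c * length T)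
  Σ<-fibre-mult± c c<n = begin
    Σ< (λ q → mult± N sumsW (q * n + c)) m
      ≡⟨ Σ<-+ (λ q → mult (q * n + c) sumsW) (λ q → mult (q * n + c) (map negN sumsW)) m ⟩
    Σ< (λ q → mult (q * n + c) sumsW) m + Σ< (λ q → mult (q * n + c) (map negN sumsW)) m
      ≡⟨ cong₂ _+_ (Σ<-fibre-sumsW c c<n) (Σ<-fibre-negSumsW c c<n) ⟩
    (a * m + i) + (b * m + i)
      ≡⟨ solve 4 (λ a b m i → (a :* m :+ i) :+ (b :* m :+ i) := (a :+ b) :* m :+ (i :+ i)) refl a b m i ⟩
    (a + b) * m + (i + i) ∎
    where
    open ≡-Reasoning
    a = mult c (sums n S)
    b = mult c (map (negMod n) (sums n S))
    i = δ 0 c * length T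

  sumsI≤sumsW : ∀ z → mult z sumsI ≤ mult z sumsW
  sumsI≤sumsW z = subst (mult z sumsI ≤_) (sym (mult-sumsW z)) (m≤m+n _ _)

  sums-T≤sumsW : ∀ q → mult q (sums m T) ≤ mult (q * n + 0) sumsW
  sums-T≤sumsW q = subst₂ _≤_ (trans (mult-sumsII q 0 (s≤s z≤n)) (*-identityˡ _)) (sym (mult-sumsW (q * n + 0))) (m≤n+m _ _)

  negSums-T≤negSumsW : ∀ q → mult q (map (negMod m) (sums m T)) ≤ mult (q * n + 0) (map negN sumsW)
  negSums-T≤negSumsW q = begin
    mult q (map (negMod m) (sums m T))                          ≡⟨ sym (+-identityʳ _) ⟩
    δ 0 0 * mult q (map (negMod m) (sums m T))                  ≡⟨ sym (mult-digits-map q 0 0 (s≤s z≤n) (s≤s z≤n) (map (negMod m) (sums m T))) ⟩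
    mult (q * n + 0) (map (λ a → a * n + 0) (map (negMod m) (sums m T)))
                                                                ≡⟨ cong (mult (q * n + 0)) (sym negSumsII≡high) ⟩
    mult (q * n + 0) (map negN sumsII)                          ≤⟨ m≤n+m _ _ ⟩
    mult (q * n + 0) (map negN sumsI) + mult (q * n + 0) (map negN sumsII)
                                                                ≡⟨ sym (mult-++ (q * n + 0) (map negN sumsI) (map negN sumsII)) ⟩
    mult (q * n + 0) (map negN sumsI ++ map negN sumsII)        ≡⟨ cong (mult (q * n + 0)) (sym (trans (cong (map negN) sumsW≡) (map-++ negN sumsI sumsII))) ⟩
    mult (q * n + 0) (map negN sumsW)                           ∎
    where
    open ≤-Reasoning
    negSumsII≡high : map negN sumsII ≡ map (λ a → a * n + 0) (map (negMod m) (sums m T))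
    negSumsII≡high = trans (cong (map negN) sumsII≡high) (go (sums m T) sums-T-bounded)
      where
      go : ∀ as → All (_< m) as → map negN (map (λ a → a * n + 0) as) ≡ map (λ a → a * n + 0) (map (negMod m) as)
      go []       []           = refl
      go (a ∷ as) (a<m ∷ rest) = cong₂ _∷_ (negMod-high a a<m) (go as rest)

  mult±-T≤mult±-W : ∀ q → mult± m (sums m T) q ≤ mult± N sumsW (q * n + 0)
  mult±-T≤mult±-W q = +-mono-≤ (sums-T≤sumsW q) (negSums-T≤negSumsW q)

  strong⇒ : 2 ≤ n′ → IsStrong N W → IsSkewNucleus m X × IsStrong n S × IsStrong m T
  strong⇒ 2≤n′ (_ , W-strong) =
      skewNucleus-from-mult≤1 2≤n′ (λ z _ → ≤-trans (sumsI≤sumsW z) (≤-trans (W≤χ₊ z) (χ₊≤1 z)))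
    , (S-part , from (strong⇔mult≤χ₊ (sums n S)) S≤χ₊)
    , (T-part , from (strong⇔mult≤χ₊ (sums m T)) T≤χ₊)
    where
    W≤χ₊ : ∀ z → mult z sumsW ≤ χ₊ z
    W≤χ₊ = to (strong⇔mult≤χ₊ sumsW) W-strong
    S≤χ₊ : ∀ c → mult c (sums n S) ≤ χ₊ c
    S≤χ₊ c with c <? n
    ... | no  c≮n = subst (_≤ χ₊ c) (sym (mult-outOfRange (sums n S) sums-S-bounded (≮⇒≥ c≮n))) z≤n
    ... | yes c<n = fibre-bound (mult c (sums n S)) c c<n (begin
      mult c (sums n S) * m                          ≤⟨ m≤m+n _ _ ⟩
      mult c (sums n S) * m + δ 0 c * length T       ≡⟨ sym (Σ<-fibre-sumsW c c<n) ⟩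
      Σ< (λ q → mult (q * n + c) sumsW) m            ≤⟨ Σ<-mono-≤ m (λ q _ → W≤χ₊ (q * n + c)) ⟩
      Σ< (λ q → χ₊ (q * n + c)) m                    ∎)
      where open ≤-Reasoning
    T≤χ₊ : ∀ q → mult q (sums m T) ≤ χ₊ q
    T≤χ₊ q = ≤-trans (sums-T≤sumsW q) (≤-trans (W≤χ₊ (q * n + 0)) (≤-reflexive (χ₊-high q)))

  skew⇒ : 2 ≤ n′ → IsSkew N W → IsSkewNucleus m X × IsSkew n S × IsSkew m T
  skew⇒ 2≤n′ (_ , W-cover) =
      skewNucleus-from-mult≤1 2≤n′ (λ z z<N → ≤-trans (sumsI≤sumsW z) (≤-trans (m≤m+n _ _) (≤-trans (≤-reflexive (W≡χ₊ z z<N)) (χ₊≤1 z))))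
    , (S-part , mult±≡χ₊⇒signedCover n′ (sums n S) sums-S-bounded
                  (mult±≤χ₊⇒≡ n′ (sums n S) sums-S-bounded (twoPartition-length-sums n′ S S-part) S≤χ₊))
    , (T-part , mult±≡χ₊⇒signedCover m′ (sums m T) sums-T-bounded
                  (mult±≤χ₊⇒≡ m′ (sums m T) sums-T-bounded (twoPartition-length-sums m′ T T-part) T≤χ₊))
    where
    W≡χ₊ : ∀ z → z < N → mult± N sumsW z ≡ χ₊ z
    W≡χ₊ = signedCover⇒mult±≡χ₊ (pred N) sumsW sumsW-bounded length-sumsW W-cover
    S≤χ₊ : ∀ c → c < n → mult± n (sums n S) c ≤ χ₊ c
    S≤χ₊ c c<n = fibre-bound (mult± n (sums n S) c) c c<n (begin
      mult± n (sums n S) c * m                                               ≤⟨ m≤m+n _ _ ⟩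
      mult± n (sums n S) c * m + (δ 0 c * length T + δ 0 c * length T)      ≡⟨ sym (Σ<-fibre-mult± c c<n) ⟩
      Σ< (λ q → mult± N sumsW (q * n + c)) m                                 ≡⟨ Σ<-cong m (λ q q<m → W≡χ₊ (q * n + c) (digits< q c q<m c<n)) ⟩
      Σ< (λ q → χ₊ (q * n + c)) m                                             ∎)
      where open ≤-Reasoning
    T≤χ₊ : ∀ q → q < m → mult± m (sums m T) q ≤ χ₊ q
    T≤χ₊ q q<m = ≤-trans (mult±-T≤mult±-W q) (≤-reflexive (trans (W≡χ₊ (q * n + 0) (digits< q 0 q<m (s≤s z≤n))) (χ₊-high q)))

  strong⇐ : IsSkewNucleus m X × IsStrong n S × IsStrong m T → IsStrong N W
  strong⇐ (X-skew , (_ , S-strong) , (_ , T-strong)) = W-isTwoPartition , from (strong⇔mult≤χ₊ sumsW) W≤χ₊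
    where
    S≤χ₊ : ∀ c → mult c (sums n S) ≤ χ₊ c
    S≤χ₊ = to (strong⇔mult≤χ₊ (sums n S)) S-strong
    T≤χ₊ : ∀ q → mult q (sums m T) ≤ χ₊ q
    T≤χ₊ = to (strong⇔mult≤χ₊ (sums m T)) T-strong
    digitwise : ∀ q c → q < m → c < n → mult (q * n + c) sumsW ≤ χ₊ (q * n + c)
    digitwise q zero q<m c<n rewrite mult-sumsW-skew X-skew q 0 q<m c<n | n≤0⇒n≡0 (S≤χ₊ 0) | χ₊-high q =
      ≤-trans (≤-reflexive (+-identityʳ _)) (T≤χ₊ q)
    digitwise q (suc c) q<m c<n rewrite mult-sumsW-skew X-skew q (suc c) q<m c<n | χ₊-low q c =
      ≤-trans (≤-reflexive (+-identityʳ _)) (S≤χ₊ (suc c))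
    W≤χ₊ : ∀ z → mult z sumsW ≤ χ₊ z
    W≤χ₊ z with z <? N
    ... | yes z<N = by-digits (λ z → mult z sumsW ≤ χ₊ z) digitwise z z<N
    ... | no  z≮N = subst (_≤ χ₊ z) (sym (mult-outOfRange sumsW sumsW-bounded (≮⇒≥ z≮N))) z≤n

  skew⇐ : IsSkewNucleus m X × IsSkew n S × IsSkew m T → IsSkew N W
  skew⇐ (X-skew , (_ , S-cover) , (_ , T-cover)) =
    W-isTwoPartition ,
    mult±≡χ₊⇒signedCover (pred N) sumsW sumsW-bounded
      (χ₊≤mult±⇒≡ (pred N) sumsW sumsW-bounded length-sumsW (by-digits (λ z → χ₊ z ≤ mult± N sumsW z) digitwise))
    where
    S≡χ₊ : ∀ c → c < n → mult± n (sums n S) c ≡ χ₊ c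
    S≡χ₊ = signedCover⇒mult±≡χ₊ n′ (sums n S) sums-S-bounded (twoPartition-length-sums n′ S S-part) S-cover
    T≡χ₊ : ∀ q → q < m → mult± m (sums m T) q ≡ χ₊ q
    T≡χ₊ = signedCover⇒mult±≡χ₊ m′ (sums m T) sums-T-bounded (twoPartition-length-sums m′ T T-part) T-cover
    -- A nonzero low digit c is covered either by c ∈ sums n S directly, or by −c ∈ sums n S through −z.
    low-covered : ∀ q c → q < m → suc c < n → 0 < mult± N sumsW (q * n + suc c)
    low-covered q c q<m c<n with 0 <? mult (suc c) (sums n S)
    ... | yes pos = ≤-trans pos (≤-trans (≤-reflexive (sym (trans (mult-sumsW-skew X-skew q (suc c) q<m c<n) (+-identityʳ _)))) (m≤m+n _ _))
    ... | no  ¬pos = begin-strict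
      0                                     <⟨ 0<mult-negMod⇒0<mult n′ (sums n S) (suc c) sums-S-bounded neg-pos ⟩
      mult (negMod n (suc c)) (sums n S)    ≡⟨ cong (λ v → mult v (sums n S)) (sym (negMod-%n q (suc c) q<m c<n)) ⟩
      mult (negN z % n) (sums n S)          ≤⟨ mult-%n≤mult-sumsW X-skew (negN z) (negMod< (pred N) z) ⟩
      mult (negN z) sumsW                   ≤⟨ mult≤mult-map negN (negN z) sumsW ⟩
      mult (negN (negN z)) (map negN sumsW) ≡⟨ cong (λ v → mult v (map negN sumsW)) (negMod-involutive (pred N) z (digits< q (suc c) q<m c<n)) ⟩
      mult z (map negN sumsW)               ≤⟨ m≤n+m _ _ ⟩
      mult± N sumsW z                      ∎
      where
      open ≤-Reasoning
      z = q * n + suc c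
      neg-pos : 0 < mult (suc c) (map (negMod n) (sums n S))
      neg-pos = subst (0 <_) (sym (trans (cong (_+ mult (suc c) (map (negMod n) (sums n S))) (sym (n≤0⇒n≡0 (≮⇒≥ ¬pos)))) (S≡χ₊ (suc c) c<n))) (s≤s z≤n)
    digitwise : ∀ q c → q < m → c < n → χ₊ (q * n + c) ≤ mult± N sumsW (q * n + c)
    digitwise q zero    q<m _   = subst (_≤ mult± N sumsW (q * n + 0)) (trans (T≡χ₊ q q<m) (sym (χ₊-high q))) (mult±-T≤mult±-W q)
    digitwise q (suc c) q<m c<n = subst (_≤ mult± N sumsW (q * n + suc c)) (sym (χ₊-low q c)) (low-covered q c q<m c<n)

theorem3p18 : (n m : ℕ) → 3 ≤ n → 3 ≤ m → IsOdd n → IsOdd m →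
    (S T X : Pairs) →
    IsTwoPartition n S → IsTwoPartition m T → IsNucleus m X →
    (IsStrong (m * n) (Wprod n m S T X) ⇔ (IsSkewNucleus m X × IsStrong n S × IsStrong m T))
    × (IsSkew (m * n) (Wprod n m S T X) ⇔ (IsSkewNucleus m X × IsSkew n S × IsSkew m T))
theorem3p18 (suc n′) (suc m′) (s≤s 2≤n′) _ _ _ S T X S-part T-part X-nucleus =
  mk⇔ (strong⇒ 2≤n′) strong⇐ , mk⇔ (skew⇒ 2≤n′) skew⇐
  where open Product n′ m′ S T X S-part T-part X-nucleus
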